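{- Let $n\ge2$, let $M_1,M_2,\ldots,M_k\in\mathrm{H}(n,\mathbb{Q}(\mathrm{i}))$ be such that $M_1M_2\cdots M_k\in\Omega$, and let $\ell\ge1$ be an integer. Write $\psi(M_i)=(\bm{a}_i,\bm{b}_i,c_i)$ for $i=1,\ldots,k$. Then \[(M_1^\ell M_2^\ell\cdots M_k^\ell)_{1,n}=\ell\sum_{i=1}^k\Big(c_i-\tfrac12\bm{a}_i^T\bm{b}_i\Big)+\frac{\ell^2}{2}\sum_{1\le i<j\le k-1}[M_i,M_j].\]
   Context: $\mathrm{H}(n,\mathbb{Q}(\mathrm{i}))$ is the set of $n\times n$ matrices $M=\begin{pmatrix}1&\bm{m}_1^T&m_3\\ \bm{0}&\bm{I}_{n-2}&\bm{m}_2\\ 0&\bm{0}^T&1\end{pmatrix}$ with $\bm{m}_1,\bm{m}_2\in\mathbb{Q}(\mathrm{i})^{n-2}$, $m_3\in\mathbb{Q}(\mathrm{i})$ (where $\mathbb{Q}(\mathrm{i})=\{a+b\mathrm{i}: a,b\in\mathbb{Q}\}$); for such $M$, $\psi(M)=(\bm{m}_1,\bm{m}_2,m_3)$ and $M_{1,n}=m_3$ is its top-right entry. $\Omega$ is the set of such matrices with $\bm{m}_1=\bm{m}_2=\bm{0}$. For $M_1,M_2$ with $\psi(M_1)=(\bm{a}_1,\bm{b}_1,c_1)$, $\psi(M_2)=(\bm{a}_2,\bm{b}_2,c_2)$, the commutator is the scalar $[M_1,M_2]=\bm{a}_1^T\bm{b}_2-\bm{a}_2^T\bm{b}_1\in\mathbb{Q}(\mathrm{i})$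 (transpose without conjugation). -}

module Defs where

open import Data.Nat as ℕ using (ℕ; zero; suc)
open import Data.Fin as Fin using (Fin; zero; suc; toℕ; fromℕ)
open import Data.Maybe using (Maybe; just; nothing)
import Data.Maybe as Maybe
open import Data.Bool using (Bool; true; false; if_then_else_; _∧_)
open import Relation.Nullary using (does)
open import Relation.Binary.PropositionalEquality using (_≡_)
open import Data.Product using (∃; _×_; _,_)
open import Data.Rational as ℚ using (ℚ; ½)
import Data.Integer

record ℚi : Set where
  constructor _+_i
  field
    re : ℚ
    im : ℚ
open ℚi public

infixl 6 _⊕_ _⊖_
infixl 7 _⊛_

_⊕_ : ℚi → ℚi → ℚi
(a + b i) ⊕ (c + d i) = (a ℚ.+ c) + (b ℚ.+ d) i

⊝_ : ℚi → ℚi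
⊝ (a + b i) = (ℚ.- a) + (ℚ.- b) i

_⊖_ : ℚi → ℚi → ℚi
x ⊖ y = x ⊕ (⊝ y)

_⊛_ : ℚi → ℚi → ℚi
(a + b i) ⊛ (c + d i) = (a ℚ.* c ℚ.- b ℚ.* d) + (a ℚ.* d ℚ.+ b ℚ.* c) i

ι : ℚ → ℚi
ι q = q + ℚ.0ℚ i

𝟘 𝟙 : ℚi
𝟘 = ι ℚ.0ℚ
𝟙 = ι ℚ.1ℚ

ιℕ : ℕ → ℚi
ιℕ n = ι (Data.Integer.+ n ℚ./ 1)

sumFin : ∀ k → (Fin k → ℚi) → ℚi
sumFin zero    f = 𝟘
sumFin (suc k) f = f zero ⊕ sumFin k (λ j → f (suc j))

-- dot product without conjugation  a^T b
dot : ∀ {m} → (Fin m → ℚi) → (Fin m → ℚi) → ℚi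
dot {m} a b = sumFin m (λ j → a j ⊛ b j)

Mat : ℕ → Set
Mat n = Fin n → Fin n → ℚi

_·_ : ∀ {n} → Mat n → Mat n → Mat n
_·_ {n} A B r s = sumFin n (λ t → A r t ⊛ B t s)

δ : ∀ {n} → Fin n → Fin n → ℚi
δ r s = if does (r Fin.≟ s) then 𝟙 else 𝟘

Id : ∀ {n} → Mat n
Id = δ

_^_ : ∀ {n} → Mat n → ℕ → Mat n
M ^ zero  = Id
M ^ suc ℓ = M · (M ^ ℓ)

prodF : ∀ {n} k → (Fin k → Mat n) → Mat n
prodF zero    M = Id
prodF (suc k) M = M zero · prodF k (λ j → M (suc j))

-- Heisenberg-type matrices in dimension n = m + 2
-- Index positions of Fin (suc (suc m)): first (index 1), middle
-- (indices 2..n-1, identified with Fin m), last (index n).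

-- classify an index of Fin (suc m): nothing = last, just j = j-th middle
cls : ∀ m → Fin (suc m) → Maybe (Fin m)
cls zero    zero    = nothing
cls (suc m) zero    = just zero
cls (suc m) (suc j) = Maybe.map suc (cls m j)

-- entries of the block matrix  [[1, a^T, c], [0, I, b], [0, 0^T, 1]]
entryH : ∀ {m} → (Fin m → ℚi) → (Fin m → ℚi) → ℚi →
         Fin (suc (suc m)) → Fin (suc (suc m)) → ℚi
entryH {m} a b c zero zero    = 𝟙
entryH {m} a b c zero (suc s) with cls m s
... | just q  = a q
... | nothing = c
entryH {m} a b c (suc r) zero = 𝟘
entryH {m} a b c (suc r) (suc s) with cls m r | cls m s
... | just p  | just q  = δ p q
... | just p  | nothing = b p
... | nothing | just q  = 𝟘
... | nothing | nothing = 𝟙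

HMat : ∀ {m} → (Fin m → ℚi) → (Fin m → ℚi) → ℚi → Mat (suc (suc m))
HMat = entryH

IsH : ∀ {m} → Mat (suc (suc m)) → Set
IsH {m} M = ∃ λ (a : Fin m → ℚi) → ∃ λ (b : Fin m → ℚi) → ∃ λ (c : ℚi) →
            ∀ r s → M r s ≡ HMat a b c r s

IsΩ : ∀ {m} → Mat (suc (suc m)) → Set
IsΩ {m} M = ∃ λ (c : ℚi) → ∀ r s → M r s ≡ HMat (λ _ → 𝟘) (λ _ → 𝟘) c r s

topRight : ∀ {m} → Mat (suc (suc m)) → ℚi
topRight {m} M = M zero (fromℕ (suc m))

record Hdata (m : ℕ) : Set where
  constructor ψdata
  field
    𝐚 : Fin m → ℚi
    𝐛 : Fin m → ℚi
    𝐜 : ℚi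
open Hdata public

toMat : ∀ {m} → Hdata m → Mat (suc (suc m))
toMat d = HMat (𝐚 d) (𝐛 d) (𝐜 d)

comm : ∀ {m} → Hdata m → Hdata m → ℚi
comm d₁ d₂ = dot (𝐚 d₁) (𝐛 d₂) ⊖ dot (𝐚 d₂) (𝐛 d₁)

-- ∑_{1 ≤ i < j ≤ k-1} [M_i, M_j]  (1-based; 0-based: i < j and j + 1 < k)
commSum : ∀ {m} k → (Fin k → Hdata m) → ℚi
commSum k d = sumFin k (λ i → sumFin k (λ j →
  if does (toℕ i ℕ.<? toℕ j) ∧ does (suc (toℕ j) ℕ.<? k)
  then comm (d i) (d j) else 𝟘))

-- ψ turns matrix multiplication in H(n, ℚ(i)) into the law
-- (a, b, c)(a′, b′, c′) = (a + a′, b + b′, c + c′ + aᵀb′). Hence the ℓ-th power of (a, b, c) is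
-- (ℓa, ℓb, ℓc + ℓ(ℓ-1)/2 aᵀb), and a product of x₁, …, x_k has top-right entry Σ cᵢ + Σ_{i<j} aᵢᵀbⱼ, so
--   (M₁^ℓ ⋯ M_k^ℓ)_{1,n} = ℓ Σ (cᵢ - ½ aᵢᵀbᵢ) + ½ℓ² (Σ aᵢᵀbᵢ + 2 Σ_{i<j} aᵢᵀbⱼ).
-- If M₁ ⋯ M_k ∈ Ω then Σ aᵢ = Σ bᵢ = 0, and expanding 0 = (Σ aᵢ)ᵀ(Σ bᵢ) turns the bracket into
-- Σ_{i<j} [Mᵢ, Mⱼ]; the terms with j = k vanish for the same reason.

module Submission where

open import Defs
open import Data.Nat using (ℕ; zero; suc; _≤_; _*_; _<?_)
open import Data.Fin using (Fin; zero; suc; inject₁; fromℕ; toℕ)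
open import Data.Rational using (½)
open import Relation.Binary.PropositionalEquality using (_≡_)

open import Level using (0ℓ)
open import Data.Bool using (if_then_else_; _∧_)
open import Data.List using (_∷_; [])
open import Data.Maybe using (Maybe; just; nothing; zipWith)
import Data.Maybe as Maybe
open import Data.Product using (_×_; _,_; proj₁; proj₂)
open import Function using (_∘_)
import Data.Fin.Relation.Unary.Top as Top
open import Data.Integer using (+_)
import Data.Integer as ℤ
import Data.Integer.Properties as ℤₚ
import Data.Nat.Coprimality as ℕC
import Data.Rational as ℚ
import Data.Rational.Properties as ℚₚ
open import Relation.Nullary using (does)
open import Relation.Nullary.Decidable using (dec⇒maybe)
open import Relation.Binary.PropositionalEquality
  using (refl; sym; trans; cong; cong₂; isEquivalence; module ≡-Reasoning)
open import Algebra.Bundles using (CommutativeRing)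
open import Algebra.Definitions {A = ℚi} _≡_
open import Algebra.Structures {A = ℚi} _≡_ using (IsCommutativeRing)
open import Tactic.RingSolver using (solve; solve-∀)
open import Tactic.RingSolver.Core.AlmostCommutativeRing
  using (AlmostCommutativeRing; fromCommutativeRing)

open ≡-Reasoning

ℚ-ring : AlmostCommutativeRing 0ℓ 0ℓ
ℚ-ring = fromCommutativeRing ℚₚ.+-*-commutativeRing (λ x → dec⇒maybe (ℚ.0ℚ ℚₚ.≟ x))

⊕-assoc : Associative _⊕_
⊕-assoc (a + b i) (c + d i) (e + f i) = cong₂ _+_i (ℚₚ.+-assoc a c e) (ℚₚ.+-assoc b d f)

⊕-comm : Commutative _⊕_
⊕-comm (a + b i) (c + d i) = cong₂ _+_i (ℚₚ.+-comm a c) (ℚₚ.+-comm b d)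

⊕-identityˡ : LeftIdentity 𝟘 _⊕_
⊕-identityˡ (a + b i) = cong₂ _+_i (ℚₚ.+-identityˡ a) (ℚₚ.+-identityˡ b)

⊕-identityʳ : RightIdentity 𝟘 _⊕_
⊕-identityʳ (a + b i) = cong₂ _+_i (ℚₚ.+-identityʳ a) (ℚₚ.+-identityʳ b)

⊝-inverseˡ : LeftInverse 𝟘 ⊝_ _⊕_
⊝-inverseˡ (a + b i) = cong₂ _+_i (ℚₚ.+-inverseˡ a) (ℚₚ.+-inverseˡ b)

⊝-inverseʳ : RightInverse 𝟘 ⊝_ _⊕_
⊝-inverseʳ (a + b i) = cong₂ _+_i (ℚₚ.+-inverseʳ a) (ℚₚ.+-inverseʳ b)

⊛-assoc : Associative _⊛_
⊛-assoc (a + b i) (c + d i) (e + f i) = cong₂ _+_i re≡ im≡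
  where
  re≡ : (a ℚ.* c ℚ.- b ℚ.* d) ℚ.* e ℚ.- (a ℚ.* d ℚ.+ b ℚ.* c) ℚ.* f
        ≡ a ℚ.* (c ℚ.* e ℚ.- d ℚ.* f) ℚ.- b ℚ.* (c ℚ.* f ℚ.+ d ℚ.* e)
  re≡ = solve (a ∷ b ∷ c ∷ d ∷ e ∷ f ∷ []) ℚ-ring
  im≡ : (a ℚ.* c ℚ.- b ℚ.* d) ℚ.* f ℚ.+ (a ℚ.* d ℚ.+ b ℚ.* c) ℚ.* e
        ≡ a ℚ.* (c ℚ.* f ℚ.+ d ℚ.* e) ℚ.+ b ℚ.* (c ℚ.* e ℚ.- d ℚ.* f)
  im≡ = solve (a ∷ b ∷ c ∷ d ∷ e ∷ f ∷ []) ℚ-ring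

⊛-comm : Commutative _⊛_
⊛-comm (a + b i) (c + d i) = cong₂ _+_i re≡ im≡
  where
  re≡ : a ℚ.* c ℚ.- b ℚ.* d ≡ c ℚ.* a ℚ.- d ℚ.* b
  re≡ = solve (a ∷ b ∷ c ∷ d ∷ []) ℚ-ring
  im≡ : a ℚ.* d ℚ.+ b ℚ.* c ≡ c ℚ.* b ℚ.+ d ℚ.* a
  im≡ = solve (a ∷ b ∷ c ∷ d ∷ []) ℚ-ring

⊛-identityˡ : LeftIdentity 𝟙 _⊛_
⊛-identityˡ (a + b i) = cong₂ _+_i re≡ im≡
  where
  re≡ : ℚ.1ℚ ℚ.* a ℚ.- ℚ.0ℚ ℚ.* b ≡ a
  re≡ = solve (a ∷ b ∷ []) ℚ-ring
  im≡ : ℚ.1ℚ ℚ.* b ℚ.+ ℚ.0ℚ ℚ.* a ≡ b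
  im≡ = solve (a ∷ b ∷ []) ℚ-ring

⊛-identityʳ : RightIdentity 𝟙 _⊛_
⊛-identityʳ x = trans (⊛-comm x 𝟙) (⊛-identityˡ x)

⊛-distribˡ-⊕ : _⊛_ DistributesOverˡ _⊕_
⊛-distribˡ-⊕ (a + b i) (c + d i) (e + f i) = cong₂ _+_i re≡ im≡
  where
  re≡ : a ℚ.* (c ℚ.+ e) ℚ.- b ℚ.* (d ℚ.+ f)
        ≡ (a ℚ.* c ℚ.- b ℚ.* d) ℚ.+ (a ℚ.* e ℚ.- b ℚ.* f)
  re≡ = solve (a ∷ b ∷ c ∷ d ∷ e ∷ f ∷ []) ℚ-ring
  im≡ : a ℚ.* (d ℚ.+ f) ℚ.+ b ℚ.* (c ℚ.+ e)
        ≡ (a ℚ.* d ℚ.+ b ℚ.* c) ℚ.+ (a ℚ.* f ℚ.+ b ℚ.* e)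
  im≡ = solve (a ∷ b ∷ c ∷ d ∷ e ∷ f ∷ []) ℚ-ring

⊛-distribʳ-⊕ : _⊛_ DistributesOverʳ _⊕_
⊛-distribʳ-⊕ x y z = begin
  (y ⊕ z) ⊛ x       ≡⟨ ⊛-comm (y ⊕ z) x ⟩
  x ⊛ (y ⊕ z)       ≡⟨ ⊛-distribˡ-⊕ x y z ⟩
  x ⊛ y ⊕ x ⊛ z     ≡⟨ cong₂ _⊕_ (⊛-comm x y) (⊛-comm x z) ⟩
  y ⊛ x ⊕ z ⊛ x     ∎

ℚi-isCommutativeRing : IsCommutativeRing _⊕_ _⊛_ ⊝_ 𝟘 𝟙
ℚi-isCommutativeRing = record
  { isRing = record
    { +-isAbelianGroup = record
      { isGroup = record
        { isMonoid = record
          { isSemigroup = record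
            { isMagma = record { isEquivalence = isEquivalence ; ∙-cong = cong₂ _⊕_ }
            ; assoc = ⊕-assoc }
          ; identity = ⊕-identityˡ , ⊕-identityʳ }
        ; inverse = ⊝-inverseˡ , ⊝-inverseʳ
        ; ⁻¹-cong = cong ⊝_ }
      ; comm = ⊕-comm }
    ; *-cong = cong₂ _⊛_
    ; *-assoc = ⊛-assoc
    ; *-identity = ⊛-identityˡ , ⊛-identityʳ
    ; distrib = ⊛-distribˡ-⊕ , ⊛-distribʳ-⊕ }
  ; *-comm = ⊛-comm }

ℚi-commutativeRing : CommutativeRing 0ℓ 0ℓ
ℚi-commutativeRing = record { isCommutativeRing = ℚi-isCommutativeRing }

ℚi-ring : AlmostCommutativeRing 0ℓ 0ℓ
ℚi-ring = fromCommutativeRing ℚi-commutativeRing 𝟘≟_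
  where
  𝟘≟_ : (x : ℚi) → Maybe (𝟘 ≡ x)
  𝟘≟ (a + b i) = zipWith (cong₂ _+_i) (dec⇒maybe (ℚ.0ℚ ℚₚ.≟ a)) (dec⇒maybe (ℚ.0ℚ ℚₚ.≟ b))

ℕ/1≡mkℚ : ∀ n → + n ℚ./ 1 ≡ ℚ.mkℚ (+ n) 0 (ℕC.sym (ℕC.1-coprimeTo n))
ℕ/1≡mkℚ n = ℚₚ.normalize-coprime (ℕC.sym (ℕC.1-coprimeTo n))

ℕ/1-suc : ∀ n → + suc n ℚ./ 1 ≡ ℚ.1ℚ ℚ.+ + n ℚ./ 1
ℕ/1-suc n rewrite ℕ/1≡mkℚ n = cong (λ z → (+ 1 ℤ.+ z) ℚ./ 1) (sym (ℤₚ.*-identityʳ (+ n)))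

ℕ/1-* : ∀ m n → + (m * n) ℚ./ 1 ≡ (+ m ℚ./ 1) ℚ.* (+ n ℚ./ 1)
ℕ/1-* m n rewrite ℕ/1≡mkℚ m | ℕ/1≡mkℚ n = cong (ℚ._/ 1) (ℤₚ.pos-* m n)

ι-homo-* : ∀ x y → ι (x ℚ.* y) ≡ ι x ⊛ ι y
ι-homo-* x y = cong₂ _+_i re≡ im≡
  where
  re≡ : x ℚ.* y ≡ x ℚ.* y ℚ.- ℚ.0ℚ ℚ.* ℚ.0ℚ
  re≡ = solve (x ∷ y ∷ []) ℚ-ring
  im≡ : ℚ.0ℚ ≡ x ℚ.* ℚ.0ℚ ℚ.+ ℚ.0ℚ ℚ.* y
  im≡ = solve (x ∷ y ∷ []) ℚ-ring

ιℕ-suc : ∀ n → ιℕ (suc n) ≡ 𝟙 ⊕ ιℕ n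
ιℕ-suc n = cong ι (ℕ/1-suc n)

ιℕ-* : ∀ m n → ιℕ (m * n) ≡ ιℕ m ⊛ ιℕ n
ιℕ-* m n = trans (cong ι (ℕ/1-* m n)) (ι-homo-* (+ m ℚ./ 1) (+ n ℚ./ 1))

ιℕ-suc-⊛ : ∀ ℓ y → y ⊕ ιℕ ℓ ⊛ y ≡ ιℕ (suc ℓ) ⊛ y
ιℕ-suc-⊛ ℓ y = begin
  y ⊕ ιℕ ℓ ⊛ y         ≡⟨ cong (_⊕ ιℕ ℓ ⊛ y) (⊛-identityˡ y) ⟨
  𝟙 ⊛ y ⊕ ιℕ ℓ ⊛ y     ≡⟨ ⊛-distribʳ-⊕ y 𝟙 (ιℕ ℓ) ⟨
  (𝟙 ⊕ ιℕ ℓ) ⊛ y       ≡⟨ cong (_⊛ y) (ιℕ-suc ℓ) ⟨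
  ιℕ (suc ℓ) ⊛ y       ∎

open CommutativeRing ℚi-commutativeRing using (semiring; zeroˡ; zeroʳ; +-commutativeSemigroup)
open import Algebra.Properties.CommutativeSemigroup +-commutativeSemigroup
  using () renaming (interchange to ⊕-interchange)
open import Algebra.Properties.Ring (CommutativeRing.ring ℚi-commutativeRing) using (-1*x≈-x)
open import Algebra.Properties.Semiring.Sum semiring
  using (sum; sum-cong-≗; ∑-distrib-+; ∑-comm; *-distribˡ-sum; sum-init-last; sum-replicate-zero)

sumFin≡sum : ∀ k (f : Fin k → ℚi) → sumFin k f ≡ sum f
sumFin≡sum zero    f = refl
sumFin≡sum (suc k) f = cong (f zero ⊕_) (sumFin≡sum k (λ j → f (suc j)))

sumFin-cong : ∀ k {f g : Fin k → ℚi} → (∀ j → f j ≡ g j) → sumFin k f ≡ sumFin k g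
sumFin-cong k {f} {g} f≗g = begin
  sumFin k f  ≡⟨ sumFin≡sum k f ⟩
  sum f       ≡⟨ sum-cong-≗ f≗g ⟩
  sum g       ≡⟨ sumFin≡sum k g ⟨
  sumFin k g  ∎

sumFin-zero : ∀ k {f : Fin k → ℚi} → (∀ j → f j ≡ 𝟘) → sumFin k f ≡ 𝟘
sumFin-zero k f≗0 = trans (sumFin-cong k f≗0) (trans (sumFin≡sum k _) (sum-replicate-zero k))

sumFin-distrib : ∀ k (f g : Fin k → ℚi) →
                 sumFin k (λ j → f j ⊕ g j) ≡ sumFin k f ⊕ sumFin k g
sumFin-distrib k f g = begin
  sumFin k (λ j → f j ⊕ g j)  ≡⟨ sumFin≡sum k _ ⟩
  sum (λ j → f j ⊕ g j)       ≡⟨ ∑-distrib-+ f g ⟩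
  sum f ⊕ sum g               ≡⟨ cong₂ _⊕_ (sumFin≡sum k f) (sumFin≡sum k g) ⟨
  sumFin k f ⊕ sumFin k g     ∎

sumFin-scale : ∀ k x (f : Fin k → ℚi) → sumFin k (λ j → x ⊛ f j) ≡ x ⊛ sumFin k f
sumFin-scale k x f = begin
  sumFin k (λ j → x ⊛ f j)  ≡⟨ sumFin≡sum k _ ⟩
  sum (λ j → x ⊛ f j)       ≡⟨ *-distribˡ-sum x f ⟨
  x ⊛ sum f                 ≡⟨ cong (x ⊛_) (sumFin≡sum k f) ⟨
  x ⊛ sumFin k f            ∎

sumFin-init-last : ∀ k (f : Fin (suc k) → ℚi) →
                   sumFin (suc k) f ≡ sumFin k (λ j → f (inject₁ j)) ⊕ f (fromℕ k)
sumFin-init-last k f = begin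
  sumFin (suc k) f                         ≡⟨ sumFin≡sum (suc k) f ⟩
  sum f                                    ≡⟨ sum-init-last f ⟩
  sum (λ j → f (inject₁ j)) ⊕ f (fromℕ k)  ≡⟨ cong (_⊕ f (fromℕ k)) (sumFin≡sum k _) ⟨
  sumFin k (λ j → f (inject₁ j)) ⊕ f (fromℕ k) ∎

sumFin-swap : ∀ k n (f : Fin k → Fin n → ℚi) →
              sumFin k (λ i → sumFin n (f i)) ≡ sumFin n (λ j → sumFin k (λ i → f i j))
sumFin-swap k n f = begin
  sumFin k (λ i → sumFin n (f i))          ≡⟨ sumFin-cong k (λ i → sumFin≡sum n (f i)) ⟩
  sumFin k (λ i → sum (f i))               ≡⟨ sumFin≡sum k _ ⟩
  sum (λ i → sum (f i))                    ≡⟨ ∑-comm f ⟩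
  sum (λ j → sum (λ i → f i j))            ≡⟨ sumFin≡sum n _ ⟨
  sumFin n (λ j → sum (λ i → f i j))       ≡⟨ sumFin-cong n (λ j → sumFin≡sum k (λ i → f i j)) ⟨
  sumFin n (λ j → sumFin k (λ i → f i j))  ∎

sumFin-neg : ∀ k (f : Fin k → ℚi) → sumFin k (λ j → ⊝ f j) ≡ ⊝ sumFin k f
sumFin-neg k f = begin
  sumFin k (λ j → ⊝ f j)        ≡⟨ sumFin-cong k (λ j → -1*x≈-x (f j)) ⟨
  sumFin k (λ j → ⊝ 𝟙 ⊛ f j)    ≡⟨ sumFin-scale k (⊝ 𝟙) f ⟩
  ⊝ 𝟙 ⊛ sumFin k f              ≡⟨ -1*x≈-x (sumFin k f) ⟩
  ⊝ sumFin k f                  ∎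

dot-comm : ∀ {m} (u v : Fin m → ℚi) → dot u v ≡ dot v u
dot-comm {m} u v = sumFin-cong m (λ q → ⊛-comm (u q) (v q))

dot-zeroˡ : ∀ {m} {u : Fin m → ℚi} (v : Fin m → ℚi) → (∀ q → u q ≡ 𝟘) → dot u v ≡ 𝟘
dot-zeroˡ {m} v u≗0 = sumFin-zero m (λ q → trans (cong (_⊛ v q) (u≗0 q)) (zeroˡ (v q)))

dot-zeroʳ : ∀ {m} (u : Fin m → ℚi) {v : Fin m → ℚi} → (∀ q → v q ≡ 𝟘) → dot u v ≡ 𝟘
dot-zeroʳ u {v} v≗0 = trans (dot-comm u v) (dot-zeroˡ u v≗0)

dot-distribˡ : ∀ {m} (u u′ v : Fin m → ℚi) → dot (λ q → u q ⊕ u′ q) v ≡ dot u v ⊕ dot u′ v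
dot-distribˡ {m} u u′ v =
  trans (sumFin-cong m (λ q → ⊛-distribʳ-⊕ (v q) (u q) (u′ q))) (sumFin-distrib m _ _)

dot-distribʳ : ∀ {m} (u v v′ : Fin m → ℚi) → dot u (λ q → v q ⊕ v′ q) ≡ dot u v ⊕ dot u v′
dot-distribʳ u v v′ = begin
  dot u (λ q → v q ⊕ v′ q)  ≡⟨ dot-comm u _ ⟩
  dot (λ q → v q ⊕ v′ q) u  ≡⟨ dot-distribˡ v v′ u ⟩
  dot v u ⊕ dot v′ u        ≡⟨ cong₂ _⊕_ (dot-comm v u) (dot-comm v′ u) ⟩
  dot u v ⊕ dot u v′        ∎

dot-scaleˡ : ∀ {m} x (u v : Fin m → ℚi) → dot (λ q → x ⊛ u q) v ≡ x ⊛ dot u v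
dot-scaleˡ {m} x u v = trans (sumFin-cong m (λ q → ⊛-assoc x (u q) (v q))) (sumFin-scale m x _)

dot-scaleʳ : ∀ {m} x (u v : Fin m → ℚi) → dot u (λ q → x ⊛ v q) ≡ x ⊛ dot u v
dot-scaleʳ x u v = begin
  dot u (λ q → x ⊛ v q)  ≡⟨ dot-comm u _ ⟩
  dot (λ q → x ⊛ v q) u  ≡⟨ dot-scaleˡ x v u ⟩
  x ⊛ dot v u            ≡⟨ cong (x ⊛_) (dot-comm v u) ⟩
  x ⊛ dot u v            ∎

dot-sumˡ : ∀ {m} k (v : Fin k → Fin m → ℚi) (u : Fin m → ℚi) →
           dot (λ q → sumFin k (λ j → v j q)) u ≡ sumFin k (λ j → dot (v j) u)
dot-sumˡ {m} k v u = begin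
  sumFin m (λ q → sumFin k (λ j → v j q) ⊛ u q)  ≡⟨ sumFin-cong m pull-in ⟩
  sumFin m (λ q → sumFin k (λ j → v j q ⊛ u q))  ≡⟨ sumFin-swap m k _ ⟩
  sumFin k (λ j → dot (v j) u)                   ∎
  where
  pull-in : ∀ q → sumFin k (λ j → v j q) ⊛ u q ≡ sumFin k (λ j → v j q ⊛ u q)
  pull-in q = trans (⊛-comm _ (u q)) (trans (sym (sumFin-scale k (u q) _))
                (sumFin-cong k (λ j → ⊛-comm (u q) (v j q))))

dot-sumʳ : ∀ {m} k (u : Fin m → ℚi) (v : Fin k → Fin m → ℚi) →
           dot u (λ q → sumFin k (λ j → v j q)) ≡ sumFin k (λ j → dot u (v j))
dot-sumʳ k u v = begin
  dot u (λ q → sumFin k (λ j → v j q))  ≡⟨ dot-comm u _ ⟩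
  dot (λ q → sumFin k (λ j → v j q)) u  ≡⟨ dot-sumˡ k v u ⟩
  sumFin k (λ j → dot (v j) u)          ≡⟨ sumFin-cong k (λ j → dot-comm (v j) u) ⟩
  sumFin k (λ j → dot u (v j))          ∎

dot-cong : ∀ {m} {u u′ v v′ : Fin m → ℚi} →
           (∀ q → u q ≡ u′ q) → (∀ q → v q ≡ v′ q) → dot u v ≡ dot u′ v′
dot-cong {m} u≗u′ v≗v′ = sumFin-cong m (λ q → cong₂ _⊛_ (u≗u′ q) (v≗v′ q))

dot-congʳ : ∀ {m} (u : Fin m → ℚi) {v v′ : Fin m → ℚi} → (∀ q → v q ≡ v′ q) → dot u v ≡ dot u v′
dot-congʳ {m} u v≗v′ = sumFin-cong m (λ q → cong (u q ⊛_) (v≗v′ q))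

sumPairs : ∀ k → (Fin k → Fin k → ℚi) → ℚi
sumPairs zero    f = 𝟘
sumPairs (suc k) f = sumFin k (λ j → f zero (suc j)) ⊕ sumPairs k (λ i j → f (suc i) (suc j))

sumPairs-cong : ∀ k {f g : Fin k → Fin k → ℚi} → (∀ i j → f i j ≡ g i j) →
                sumPairs k f ≡ sumPairs k g
sumPairs-cong zero    f≗g = refl
sumPairs-cong (suc k) f≗g = cong₂ _⊕_ (sumFin-cong k (λ j → f≗g zero (suc j)))
                                      (sumPairs-cong k (λ i j → f≗g (suc i) (suc j)))

sumPairs-distrib : ∀ k (f g : Fin k → Fin k → ℚi) →
                   sumPairs k (λ i j → f i j ⊕ g i j) ≡ sumPairs k f ⊕ sumPairs k g
sumPairs-distrib zero    f g = sym (⊕-identityˡ 𝟘)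
sumPairs-distrib (suc k) f g = begin
  sumFin k (λ j → F j ⊕ G j) ⊕ sumPairs k (λ i j → f′ i j ⊕ g′ i j)
    ≡⟨ cong₂ _⊕_ (sumFin-distrib k F G) (sumPairs-distrib k f′ g′) ⟩
  (sumFin k F ⊕ sumFin k G) ⊕ (sumPairs k f′ ⊕ sumPairs k g′)
    ≡⟨ ⊕-interchange (sumFin k F) (sumFin k G) (sumPairs k f′) (sumPairs k g′) ⟩
  (sumFin k F ⊕ sumPairs k f′) ⊕ (sumFin k G ⊕ sumPairs k g′)
    ∎
  where
  F = λ j → f zero (suc j)
  G = λ j → g zero (suc j)
  f′ = λ i j → f (suc i) (suc j)
  g′ = λ i j → g (suc i) (suc j)

sumPairs-scale : ∀ k x (f : Fin k → Fin k → ℚi) →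
                 sumPairs k (λ i j → x ⊛ f i j) ≡ x ⊛ sumPairs k f
sumPairs-scale zero    x f = sym (zeroʳ x)
sumPairs-scale (suc k) x f =
  trans (cong₂ _⊕_ (sumFin-scale k x _) (sumPairs-scale k x _)) (sym (⊛-distribˡ-⊕ x _ _))

sumPairs-init-last : ∀ k (f : Fin (suc k) → Fin (suc k) → ℚi) →
  sumPairs (suc k) f ≡ sumPairs k (λ i j → f (inject₁ i) (inject₁ j))
                       ⊕ sumFin k (λ i → f (inject₁ i) (fromℕ k))
sumPairs-init-last zero    f = refl
sumPairs-init-last (suc k) f = begin
  sumFin (suc k) (λ j → f zero (suc j)) ⊕ sumPairs (suc k) f′
    ≡⟨ cong₂ _⊕_ (sumFin-init-last k (λ j → f zero (suc j))) (sumPairs-init-last k f′) ⟩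
  (row ⊕ corner) ⊕ (inner ⊕ column)  ≡⟨ ⊕-interchange row corner inner column ⟩
  (row ⊕ inner) ⊕ (corner ⊕ column)  ∎
  where
  f′ = λ i j → f (suc i) (suc j)
  row    = sumFin k (λ j → f zero (suc (inject₁ j)))
  corner = f zero (suc (fromℕ k))
  inner  = sumPairs k (λ i j → f′ (inject₁ i) (inject₁ j))
  column = sumFin k (λ i → f′ (inject₁ i) (fromℕ k))

sumPairs-neg : ∀ k (f : Fin k → Fin k → ℚi) → sumPairs k (λ i j → ⊝ f i j) ≡ ⊝ sumPairs k f
sumPairs-neg k f = begin
  sumPairs k (λ i j → ⊝ f i j)      ≡⟨ sumPairs-cong k (λ i j → -1*x≈-x (f i j)) ⟨
  sumPairs k (λ i j → ⊝ 𝟙 ⊛ f i j)  ≡⟨ sumPairs-scale k (⊝ 𝟙) f ⟩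
  ⊝ 𝟙 ⊛ sumPairs k f                ≡⟨ -1*x≈-x (sumPairs k f) ⟩
  ⊝ sumPairs k f                    ∎

-- The group law in ψ-coordinates

infixl 7 _∙_

_∙_ : ∀ {m} → Hdata m → Hdata m → Hdata m
x ∙ y = ψdata (λ q → 𝐚 x q ⊕ 𝐚 y q) (λ q → 𝐛 x q ⊕ 𝐛 y q) (𝐜 x ⊕ 𝐜 y ⊕ dot (𝐚 x) (𝐛 y))

ε : ∀ {m} → Hdata m
ε = ψdata (λ _ → 𝟘) (λ _ → 𝟘) 𝟘

_∙^_ : ∀ {m} → Hdata m → ℕ → Hdata m
x ∙^ zero  = ε
x ∙^ suc ℓ = x ∙ (x ∙^ ℓ)

∏ : ∀ {m} k → (Fin k → Hdata m) → Hdata m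
∏ zero    x = ε
∏ (suc k) x = x zero ∙ ∏ k (λ i → x (suc i))

∙^-𝐚 : ∀ {m} (x : Hdata m) ℓ q → 𝐚 (x ∙^ ℓ) q ≡ ιℕ ℓ ⊛ 𝐚 x q
∙^-𝐚 x zero    q = sym (zeroˡ (𝐚 x q))
∙^-𝐚 x (suc ℓ) q = trans (cong (𝐚 x q ⊕_) (∙^-𝐚 x ℓ q)) (ιℕ-suc-⊛ ℓ (𝐚 x q))

∙^-𝐛 : ∀ {m} (x : Hdata m) ℓ q → 𝐛 (x ∙^ ℓ) q ≡ ιℕ ℓ ⊛ 𝐛 x q
∙^-𝐛 x zero    q = sym (zeroˡ (𝐛 x q))
∙^-𝐛 x (suc ℓ) q = trans (cong (𝐛 x q ⊕_) (∙^-𝐛 x ℓ q)) (ιℕ-suc-⊛ ℓ (𝐛 x q))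

∙^-𝐜 : ∀ {m} (x : Hdata m) ℓ →
       𝐜 (x ∙^ ℓ) ≡ ιℕ ℓ ⊛ (𝐜 x ⊖ ι ½ ⊛ dot (𝐚 x) (𝐛 x))
                    ⊕ ι ½ ⊛ (ιℕ ℓ ⊛ ιℕ ℓ) ⊛ dot (𝐚 x) (𝐛 x)
∙^-𝐜 x zero    = base (𝐜 x) (dot (𝐚 x) (𝐛 x))
  where
  base : ∀ c X → 𝟘 ≡ 𝟘 ⊛ (c ⊖ ι ½ ⊛ X) ⊕ ι ½ ⊛ (𝟘 ⊛ 𝟘) ⊛ X
  base = solve-∀ ℚi-ring
∙^-𝐜 x (suc ℓ) = begin
  𝐜 x ⊕ 𝐜 (x ∙^ ℓ) ⊕ dot (𝐚 x) (𝐛 (x ∙^ ℓ))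
    ≡⟨ cong₂ (λ c′ X′ → 𝐜 x ⊕ c′ ⊕ X′) (∙^-𝐜 x ℓ)
             (trans (dot-congʳ (𝐚 x) (∙^-𝐛 x ℓ)) (dot-scaleʳ (ιℕ ℓ) (𝐚 x) (𝐛 x))) ⟩
  𝐜 x ⊕ (L ⊛ (𝐜 x ⊖ ι ½ ⊛ X) ⊕ ι ½ ⊛ (L ⊛ L) ⊛ X) ⊕ L ⊛ X
    ≡⟨ step (𝐜 x) X L ⟩
  (𝟙 ⊕ L) ⊛ (𝐜 x ⊖ ι ½ ⊛ X) ⊕ ι ½ ⊛ ((𝟙 ⊕ L) ⊛ (𝟙 ⊕ L)) ⊛ X
    ≡⟨ cong (λ L′ → L′ ⊛ (𝐜 x ⊖ ι ½ ⊛ X) ⊕ ι ½ ⊛ (L′ ⊛ L′) ⊛ X) (ιℕ-suc ℓ) ⟨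
  ιℕ (suc ℓ) ⊛ (𝐜 x ⊖ ι ½ ⊛ X) ⊕ ι ½ ⊛ (ιℕ (suc ℓ) ⊛ ιℕ (suc ℓ)) ⊛ X
    ∎
  where
  L = ιℕ ℓ
  X = dot (𝐚 x) (𝐛 x)
  step : ∀ c X L → c ⊕ (L ⊛ (c ⊖ ι ½ ⊛ X) ⊕ ι ½ ⊛ (L ⊛ L) ⊛ X) ⊕ L ⊛ X
                   ≡ (𝟙 ⊕ L) ⊛ (c ⊖ ι ½ ⊛ X) ⊕ ι ½ ⊛ ((𝟙 ⊕ L) ⊛ (𝟙 ⊕ L)) ⊛ X
  step = solve-∀ ℚi-ring

𝐚Σ 𝐛Σ : ∀ {m} k → (Fin k → Hdata m) → Fin m → ℚi
𝐚Σ k x q = sumFin k (λ i → 𝐚 (x i) q)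
𝐛Σ k x q = sumFin k (λ i → 𝐛 (x i) q)

pairing : ∀ {m k} → (Fin k → Hdata m) → Fin k → Fin k → ℚi
pairing x s t = dot (𝐚 (x s)) (𝐛 (x t))

diagonalPairings upperPairings lowerPairings : ∀ {m} k → (Fin k → Hdata m) → ℚi
diagonalPairings k x = sumFin k (λ i → pairing x i i)
upperPairings    k x = sumPairs k (λ i j → pairing x i j)
lowerPairings    k x = sumPairs k (λ i j → pairing x j i)

∏-𝐚 : ∀ {m} k (x : Fin k → Hdata m) q → 𝐚 (∏ k x) q ≡ 𝐚Σ k x q
∏-𝐚 zero    x q = refl
∏-𝐚 (suc k) x q = cong (𝐚 (x zero) q ⊕_) (∏-𝐚 k (λ i → x (suc i)) q)

∏-𝐛 : ∀ {m} k (x : Fin k → Hdata m) q → 𝐛 (∏ k x) q ≡ 𝐛Σ k x q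
∏-𝐛 zero    x q = refl
∏-𝐛 (suc k) x q = cong (𝐛 (x zero) q ⊕_) (∏-𝐛 k (λ i → x (suc i)) q)

∏-𝐜 : ∀ {m} k (x : Fin k → Hdata m) → 𝐜 (∏ k x) ≡ sumFin k (λ i → 𝐜 (x i)) ⊕ upperPairings k x
∏-𝐜 zero    x = refl
∏-𝐜 (suc k) x = begin
  𝐜 (x zero) ⊕ 𝐜 (∏ k x′) ⊕ dot (𝐚 (x zero)) (𝐛 (∏ k x′))
    ≡⟨ cong₂ (λ c X → 𝐜 (x zero) ⊕ c ⊕ X) (∏-𝐜 k x′)
             (trans (dot-congʳ (𝐚 (x zero)) (∏-𝐛 k x′))
                    (dot-sumʳ k (𝐚 (x zero)) (λ j → 𝐛 (x′ j)))) ⟩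
  𝐜 (x zero) ⊕ (C′ ⊕ upperPairings k x′) ⊕ row
    ≡⟨ regroup (𝐜 (x zero)) C′ (upperPairings k x′) row ⟩
  (𝐜 (x zero) ⊕ C′) ⊕ (row ⊕ upperPairings k x′)
    ∎
  where
  x′ = λ i → x (suc i)
  C′ = sumFin k (λ i → 𝐜 (x′ i))
  row = sumFin k (λ j → pairing x zero (suc j))
  regroup : ∀ c C U R → c ⊕ (C ⊕ U) ⊕ R ≡ (c ⊕ C) ⊕ (R ⊕ U)
  regroup = solve-∀ ℚi-ring

dot-𝐚Σ-𝐛Σ : ∀ {m} k (x : Fin k → Hdata m) →
  dot (𝐚Σ k x) (𝐛Σ k x) ≡ diagonalPairings k x ⊕ (upperPairings k x ⊕ lowerPairings k x)
dot-𝐚Σ-𝐛Σ zero    x = dot-zeroˡ (λ _ → 𝟘) (λ _ → refl)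
dot-𝐚Σ-𝐛Σ (suc k) x = begin
  dot (λ q → a₀ q ⊕ A q) (λ q → b₀ q ⊕ B q)
    ≡⟨ trans (dot-distribˡ a₀ A _) (cong₂ _⊕_ (dot-distribʳ a₀ b₀ B) (dot-distribʳ A b₀ B)) ⟩
  (dot a₀ b₀ ⊕ dot a₀ B) ⊕ (dot A b₀ ⊕ dot A B)
    ≡⟨ cong₂ (λ R C → (dot a₀ b₀ ⊕ R) ⊕ (C ⊕ dot A B))
             (dot-sumʳ k a₀ (λ j → 𝐛 (x′ j))) (dot-sumˡ k (λ j → 𝐚 (x′ j)) b₀) ⟩
  (dot a₀ b₀ ⊕ row) ⊕ (column ⊕ dot A B)
    ≡⟨ cong (λ P → (dot a₀ b₀ ⊕ row) ⊕ (column ⊕ P)) (dot-𝐚Σ-𝐛Σ k x′) ⟩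
  (dot a₀ b₀ ⊕ row) ⊕ (column ⊕ (D′ ⊕ (U′ ⊕ L′)))
    ≡⟨ regroup (dot a₀ b₀) row column D′ U′ L′ ⟩
  (dot a₀ b₀ ⊕ D′) ⊕ ((row ⊕ U′) ⊕ (column ⊕ L′))
    ∎
  where
  x′ = λ i → x (suc i)
  a₀ = 𝐚 (x zero)
  b₀ = 𝐛 (x zero)
  A = 𝐚Σ k x′
  B = 𝐛Σ k x′
  row = sumFin k (λ j → pairing x zero (suc j))
  column = sumFin k (λ j → pairing x (suc j) zero)
  D′ = diagonalPairings k x′
  U′ = upperPairings k x′
  L′ = lowerPairings k x′
  regroup : ∀ X R C D U L → (X ⊕ R) ⊕ (C ⊕ (D ⊕ (U ⊕ L))) ≡ (X ⊕ D) ⊕ ((R ⊕ U) ⊕ (C ⊕ L))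
  regroup = solve-∀ ℚi-ring

𝐜-∏-∙^ : ∀ {m} k (x : Fin k → Hdata m) ℓ →
  𝐜 (∏ k (λ i → x i ∙^ ℓ))
  ≡ ιℕ ℓ ⊛ sumFin k (λ i → 𝐜 (x i) ⊖ ι ½ ⊛ dot (𝐚 (x i)) (𝐛 (x i)))
    ⊕ ι ½ ⊛ (ιℕ ℓ ⊛ ιℕ ℓ) ⊛ (diagonalPairings k x ⊕ (upperPairings k x ⊕ upperPairings k x))
𝐜-∏-∙^ k x ℓ = begin
  𝐜 (∏ k xˡ)
    ≡⟨ ∏-𝐜 k xˡ ⟩
  sumFin k (λ i → 𝐜 (xˡ i)) ⊕ upperPairings k xˡ
    ≡⟨ cong₂ _⊕_ (sumFin-cong k (λ i → ∙^-𝐜 (x i) ℓ)) (sumPairs-cong k pairing-∙^) ⟩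
  sumFin k (λ i → L ⊛ c′ i ⊕ H ⊛ pairing x i i) ⊕ sumPairs k (λ i j → L ⊛ (L ⊛ pairing x i j))
    ≡⟨ cong₂ _⊕_ (trans (sumFin-distrib k (λ i → L ⊛ c′ i) (λ i → H ⊛ pairing x i i))
                        (cong₂ _⊕_ (sumFin-scale k L c′) (sumFin-scale k H (λ i → pairing x i i))))
                 (trans (sumPairs-scale k L (λ i j → L ⊛ pairing x i j))
                        (cong (L ⊛_) (sumPairs-scale k L (pairing x)))) ⟩
  (L ⊛ sumFin k c′ ⊕ H ⊛ D) ⊕ L ⊛ (L ⊛ U)
    ≡⟨ regroup L (sumFin k c′) D U ⟩
  L ⊛ sumFin k c′ ⊕ H ⊛ (D ⊕ (U ⊕ U))
    ∎
  where
  xˡ = λ i → x i ∙^ ℓ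
  L = ιℕ ℓ
  H = ι ½ ⊛ (L ⊛ L)
  c′ = λ i → 𝐜 (x i) ⊖ ι ½ ⊛ dot (𝐚 (x i)) (𝐛 (x i))
  D = diagonalPairings k x
  U = upperPairings k x
  pairing-∙^ : ∀ i j → pairing xˡ i j ≡ L ⊛ (L ⊛ pairing x i j)
  pairing-∙^ s t = begin
    dot (𝐚 (xˡ s)) (𝐛 (xˡ t))                  ≡⟨ dot-cong (∙^-𝐚 (x s) ℓ) (∙^-𝐛 (x t) ℓ) ⟩
    dot (λ q → L ⊛ 𝐚 (x s) q) (λ q → L ⊛ 𝐛 (x t) q)  ≡⟨ dot-scaleˡ L (𝐚 (x s)) _ ⟩
    L ⊛ dot (𝐚 (x s)) (λ q → L ⊛ 𝐛 (x t) q)    ≡⟨ cong (L ⊛_) (dot-scaleʳ L (𝐚 (x s)) (𝐛 (x t))) ⟩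
    L ⊛ (L ⊛ pairing x s t)                    ∎
  regroup : ∀ L S D U → (L ⊛ S ⊕ ι ½ ⊛ (L ⊛ L) ⊛ D) ⊕ L ⊛ (L ⊛ U)
                        ≡ L ⊛ S ⊕ ι ½ ⊛ (L ⊛ L) ⊛ (D ⊕ (U ⊕ U))
  regroup = solve-∀ ℚi-ring

sumFin-drop-last : ∀ k (f : Fin (suc k) → ℚi) →
  sumFin (suc k) (λ j → if does (suc (toℕ j) <? suc k) then f j else 𝟘)
  ≡ sumFin k (λ j → f (inject₁ j))
sumFin-drop-last zero    f = refl
sumFin-drop-last (suc k) f = cong (f zero ⊕_) (sumFin-drop-last k (λ j → f (suc j)))

commSum-suc : ∀ {m} k (x : Fin (suc k) → Hdata m) →
  commSum (suc k) x ≡ sumPairs k (λ i j → comm (x (inject₁ i)) (x (inject₁ j)))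
commSum-suc zero    x = refl
-- Under suc both guards of commSum reduce to those of the shorter sum; only the first column and
-- the last index need attention.
commSum-suc (suc k) x = begin
  commSum (suc (suc k)) x
    ≡⟨ cong₂ _⊕_ (trans (⊕-identityˡ firstRow) (sumFin-drop-last k (λ j → comm (x zero) (x (suc j)))))
                 (sumFin-cong (suc k) (λ i → ⊕-identityˡ (laterRow i))) ⟩
  sumFin k (λ j → comm (x zero) (x (suc (inject₁ j)))) ⊕ commSum (suc k) x′
    ≡⟨ cong (sumFin k (λ j → comm (x zero) (x (suc (inject₁ j)))) ⊕_) (commSum-suc k x′) ⟩
  sumPairs (suc k) (λ i j → comm (x (inject₁ i)) (x (inject₁ j)))
    ∎
  where
  x′ = λ i → x (suc i)
  firstRow : ℚi
  firstRow = sumFin (suc k) (λ j → if does (suc (toℕ j) <? suc k) then comm (x zero) (x (suc j)) else 𝟘)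
  laterRow : Fin (suc k) → ℚi
  laterRow s = sumFin (suc k) (λ t →
    if does (toℕ s <? toℕ t) ∧ does (suc (toℕ t) <? suc k) then comm (x′ s) (x′ t) else 𝟘)

comm-sumˡ : ∀ {m} k (y : Fin k → Hdata m) (z : Hdata m) →
  sumFin k (λ i → comm (y i) z) ≡ dot (𝐚Σ k y) (𝐛 z) ⊖ dot (𝐚 z) (𝐛Σ k y)
comm-sumˡ k y z = begin
  sumFin k (λ i → dot (𝐚 (y i)) (𝐛 z) ⊕ ⊝ dot (𝐚 z) (𝐛 (y i)))
    ≡⟨ sumFin-distrib k (λ i → dot (𝐚 (y i)) (𝐛 z)) (λ i → ⊝ dot (𝐚 z) (𝐛 (y i))) ⟩
  sumFin k (λ i → dot (𝐚 (y i)) (𝐛 z)) ⊕ sumFin k (λ i → ⊝ dot (𝐚 z) (𝐛 (y i)))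
    ≡⟨ cong₂ _⊕_ (sym (dot-sumˡ k (λ i → 𝐚 (y i)) (𝐛 z)))
                 (trans (sumFin-neg k (λ i → dot (𝐚 z) (𝐛 (y i))))
                        (cong ⊝_ (sym (dot-sumʳ k (𝐚 z) (λ i → 𝐛 (y i)))))) ⟩
  dot (𝐚Σ k y) (𝐛 z) ⊖ dot (𝐚 z) (𝐛Σ k y)
    ∎

sumPairs-comm : ∀ {m} k (x : Fin k → Hdata m) →
  sumPairs k (λ i j → comm (x i) (x j)) ≡ upperPairings k x ⊖ lowerPairings k x
sumPairs-comm k x =
  trans (sumPairs-distrib k (λ i j → pairing x i j) (λ i j → ⊝ pairing x j i))
        (cong (upperPairings k x ⊕_) (sumPairs-neg k (λ i j → pairing x j i)))

commSum-balanced : ∀ {m} k (x : Fin k → Hdata m) → (∀ q → 𝐚Σ k x q ≡ 𝟘) → (∀ q → 𝐛Σ k x q ≡ 𝟘) →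
  diagonalPairings k x ⊕ (upperPairings k x ⊕ upperPairings k x) ≡ commSum k x
commSum-balanced zero    x _     _     = refl
commSum-balanced (suc k) x Σa≡0 Σb≡0 = begin
  D ⊕ (U ⊕ U)
    ≡⟨ split D U L ⟩
  (D ⊕ (U ⊕ L)) ⊕ (U ⊖ L)
    ≡⟨ cong₂ _⊕_ (trans (sym (dot-𝐚Σ-𝐛Σ (suc k) x)) (dot-zeroˡ (𝐛Σ (suc k) x) Σa≡0))
                 (sym (sumPairs-comm (suc k) x)) ⟩
  𝟘 ⊕ sumPairs (suc k) (λ i j → comm (x i) (x j))
    ≡⟨ trans (⊕-identityˡ (sumPairs (suc k) (λ i j → comm (x i) (x j))))
             (sumPairs-init-last k (λ i j → comm (x i) (x j))) ⟩
  sumPairs k (λ i j → comm (x (inject₁ i)) (x (inject₁ j))) ⊕ sumFin k (λ i → comm (x (inject₁ i)) xₗ)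
    ≡⟨ cong₂ _⊕_ (sym (commSum-suc k x)) last-column ⟩
  commSum (suc k) x ⊕ 𝟘
    ≡⟨ ⊕-identityʳ (commSum (suc k) x) ⟩
  commSum (suc k) x
    ∎
  where
  D = diagonalPairings (suc k) x
  U = upperPairings (suc k) x
  L = lowerPairings (suc k) x
  xₗ = x (fromℕ k)
  init = λ i → x (inject₁ i)
  split : ∀ D U L → D ⊕ (U ⊕ U) ≡ (D ⊕ (U ⊕ L)) ⊕ (U ⊖ L)
  split = solve-∀ ℚi-ring
  shift : ∀ P Q R → P ⊖ Q ≡ (P ⊕ R) ⊖ (Q ⊕ R)
  shift = solve-∀ ℚi-ring
  Σa≡0′ : ∀ q → 𝐚Σ k init q ⊕ 𝐚 xₗ q ≡ 𝟘
  Σa≡0′ q = trans (sym (sumFin-init-last k (λ i → 𝐚 (x i) q))) (Σa≡0 q)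
  Σb≡0′ : ∀ q → 𝐛Σ k init q ⊕ 𝐛 xₗ q ≡ 𝟘
  Σb≡0′ q = trans (sym (sumFin-init-last k (λ i → 𝐛 (x i) q))) (Σb≡0 q)
  last-column : sumFin k (λ i → comm (init i) xₗ) ≡ 𝟘
  last-column = begin
    sumFin k (λ i → comm (init i) xₗ)
      ≡⟨ comm-sumˡ k init xₗ ⟩
    dot (𝐚Σ k init) (𝐛 xₗ) ⊖ dot (𝐚 xₗ) (𝐛Σ k init)
      ≡⟨ shift (dot (𝐚Σ k init) (𝐛 xₗ)) (dot (𝐚 xₗ) (𝐛Σ k init)) (dot (𝐚 xₗ) (𝐛 xₗ)) ⟩
    (dot (𝐚Σ k init) (𝐛 xₗ) ⊕ dot (𝐚 xₗ) (𝐛 xₗ)) ⊖ (dot (𝐚 xₗ) (𝐛Σ k init) ⊕ dot (𝐚 xₗ) (𝐛 xₗ))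
      ≡⟨ cong₂ _⊖_ (sym (dot-distribˡ (𝐚Σ k init) (𝐚 xₗ) (𝐛 xₗ)))
                   (sym (dot-distribʳ (𝐚 xₗ) (𝐛Σ k init) (𝐛 xₗ))) ⟩
    dot (λ q → 𝐚Σ k init q ⊕ 𝐚 xₗ q) (𝐛 xₗ) ⊖ dot (𝐚 xₗ) (λ q → 𝐛Σ k init q ⊕ 𝐛 xₗ q)
      ≡⟨ cong₂ _⊖_ (dot-zeroˡ (𝐛 xₗ) Σa≡0′) (dot-zeroʳ (𝐚 xₗ) Σb≡0′) ⟩
    𝟘 ⊖ 𝟘
      ∎

-- Heisenberg matrices

cls-inject₁ : ∀ m (j : Fin m) → cls m (inject₁ j) ≡ just j
cls-inject₁ (suc m) zero    = refl
cls-inject₁ (suc m) (suc j) = cong (Maybe.map suc) (cls-inject₁ m j)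

cls-fromℕ : ∀ m → cls m (fromℕ m) ≡ nothing
cls-fromℕ zero    = refl
cls-fromℕ (suc m) = cong (Maybe.map suc) (cls-fromℕ m)

middle : ∀ {m} → Fin m → Fin (suc (suc m))
middle j = suc (inject₁ j)

last : ∀ {m} → Fin (suc (suc m))
last {m} = suc (fromℕ m)

data Position {m : ℕ} : Fin (suc (suc m)) → Set where
  at-first  : Position zero
  at-middle : ∀ j → Position (middle j)
  at-last   : Position last

position : ∀ {m} (r : Fin (suc (suc m))) → Position r
position zero = at-first
position (suc t) with Top.view t
... | Top.‵fromℕ     = at-last
... | Top.‵inject₁ j = at-middle j

module _ {m} (a b : Fin m → ℚi) (c : ℚi) where

  HMat-first-middle : ∀ q → HMat a b c zero (middle q) ≡ a q
  HMat-first-middle q rewrite cls-inject₁ m q = refl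

  HMat-first-last : HMat a b c zero last ≡ c
  HMat-first-last rewrite cls-fromℕ m = refl

  HMat-middle-middle : ∀ p q → HMat a b c (middle p) (middle q) ≡ δ p q
  HMat-middle-middle p q rewrite cls-inject₁ m p | cls-inject₁ m q = refl

  HMat-middle-last : ∀ p → HMat a b c (middle p) last ≡ b p
  HMat-middle-last p rewrite cls-inject₁ m p | cls-fromℕ m = refl

  HMat-last-middle : ∀ q → HMat a b c last (middle q) ≡ 𝟘
  HMat-last-middle q rewrite cls-fromℕ m | cls-inject₁ m q = refl

  HMat-last-last : HMat a b c last last ≡ 𝟙
  HMat-last-last rewrite cls-fromℕ m = refl

δ-sumˡ : ∀ {n} (p : Fin n) (v : Fin n → ℚi) → sumFin n (λ t → δ p t ⊛ v t) ≡ v p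
δ-sumˡ {suc n} zero    v =
  trans (cong₂ _⊕_ (⊛-identityˡ (v zero)) (sumFin-zero n (λ t → zeroˡ (v (suc t))))) (⊕-identityʳ (v zero))
δ-sumˡ {suc n} (suc p) v =
  trans (cong₂ _⊕_ (zeroˡ (v zero)) (δ-sumˡ p (λ t → v (suc t)))) (⊕-identityˡ (v (suc p)))

δ-sumʳ : ∀ {n} (q : Fin n) (v : Fin n → ℚi) → sumFin n (λ t → v t ⊛ δ t q) ≡ v q
δ-sumʳ {suc n} zero    v =
  trans (cong₂ _⊕_ (⊛-identityʳ (v zero)) (sumFin-zero n (λ t → zeroʳ (v (suc t))))) (⊕-identityʳ (v zero))
δ-sumʳ {suc n} (suc q) v =
  trans (cong₂ _⊕_ (zeroʳ (v zero)) (δ-sumʳ q (λ t → v (suc t)))) (⊕-identityˡ (v (suc q)))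

infix 4 _≋_
_≋_ : ∀ {n} → Mat n → Mat n → Set
A ≋ B = ∀ r s → A r s ≡ B r s

·-cong : ∀ {n} {A A′ B B′ : Mat n} → A ≋ A′ → B ≋ B′ → A · B ≋ A′ · B′
·-cong {n} A≋A′ B≋B′ r s = sumFin-cong n (λ t → cong₂ _⊛_ (A≋A′ r t) (B≋B′ t s))

·-identityʳ : ∀ {n} (A : Mat n) → A · Id ≋ A
·-identityʳ A r s = δ-sumʳ s (A r)

·-split : ∀ {m} (A B : Mat (suc (suc m))) r s →
  (A · B) r s ≡ A r zero ⊛ B zero s
                ⊕ (sumFin m (λ j → A r (middle j) ⊛ B (middle j) s) ⊕ A r last ⊛ B last s)
·-split {m} A B r s =
  cong (A r zero ⊛ B zero s ⊕_) (sumFin-init-last m (λ t → A r (suc t) ⊛ B (suc t) s))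

module _ {m} (a b : Fin m → ℚi) (c : ℚi) (B : Mat (suc (suc m))) where

  HMat-·-first : ∀ s →
    (HMat a b c · B) zero s ≡ B zero s ⊕ (dot a (λ j → B (middle j) s) ⊕ c ⊛ B last s)
  HMat-·-first s = trans (·-split (HMat a b c) B zero s)
    (cong₂ _⊕_ (⊛-identityˡ (B zero s))
      (cong₂ _⊕_ (sumFin-cong m (λ j → cong (_⊛ B (middle j) s) (HMat-first-middle a b c j)))
                 (cong (_⊛ B last s) (HMat-first-last a b c))))

  HMat-·-middle : ∀ p s → (HMat a b c · B) (middle p) s ≡ B (middle p) s ⊕ b p ⊛ B last s
  HMat-·-middle p s = begin
    (HMat a b c · B) (middle p) s
      ≡⟨ ·-split (HMat a b c) B (middle p) s ⟩
    𝟘 ⊛ B zero s ⊕ (sumFin m (λ j → HMat a b c (middle p) (middle j) ⊛ B (middle j) s)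
                    ⊕ HMat a b c (middle p) last ⊛ B last s)
      ≡⟨ cong₂ _⊕_ (zeroˡ (B zero s))
           (cong₂ _⊕_ (trans (sumFin-cong m (λ j → cong (_⊛ B (middle j) s) (HMat-middle-middle a b c p j)))
                             (δ-sumˡ p (λ j → B (middle j) s)))
                      (cong (_⊛ B last s) (HMat-middle-last a b c p))) ⟩
    𝟘 ⊕ (B (middle p) s ⊕ b p ⊛ B last s)
      ≡⟨ ⊕-identityˡ (B (middle p) s ⊕ b p ⊛ B last s) ⟩
    B (middle p) s ⊕ b p ⊛ B last s
      ∎

  HMat-·-last : ∀ s → (HMat a b c · B) last s ≡ B last s
  HMat-·-last s = begin
    (HMat a b c · B) last s
      ≡⟨ ·-split (HMat a b c) B last s ⟩
    𝟘 ⊛ B zero s ⊕ (sumFin m (λ j → HMat a b c last (middle j) ⊛ B (middle j) s)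
                    ⊕ HMat a b c last last ⊛ B last s)
      ≡⟨ cong₂ _⊕_ (zeroˡ (B zero s))
           (cong₂ _⊕_ (sumFin-zero m (λ j → trans (cong (_⊛ B (middle j) s) (HMat-last-middle a b c j))
                                                  (zeroˡ (B (middle j) s))))
                      (trans (cong (_⊛ B last s) (HMat-last-last a b c)) (⊛-identityˡ (B last s)))) ⟩
    𝟘 ⊕ (𝟘 ⊕ B last s)
      ≡⟨ trans (⊕-identityˡ (𝟘 ⊕ B last s)) (⊕-identityˡ (B last s)) ⟩
    B last s
      ∎

toMat-ε-identityˡ : ∀ {m} (B : Mat (suc (suc m))) → toMat ε · B ≋ B
toMat-ε-identityˡ B r s with position r
... | at-first =
  trans (HMat-·-first (𝐚 ε) (𝐛 ε) 𝟘 B s)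
        (trans (cong₂ (λ D C → B zero s ⊕ (D ⊕ C)) (dot-zeroˡ (λ j → B (middle j) s) (λ _ → refl))
                                                  (zeroˡ (B last s)))
               (⊕-identityʳ (B zero s)))
... | at-middle p =
  trans (HMat-·-middle (𝐚 ε) (𝐛 ε) 𝟘 B p s)
        (trans (cong (B (middle p) s ⊕_) (zeroˡ (B last s))) (⊕-identityʳ (B (middle p) s)))
... | at-last = HMat-·-last (𝐚 ε) (𝐛 ε) 𝟘 B s

toMat-ε : ∀ {m} → Id ≋ toMat (ε {m})
toMat-ε r s = trans (sym (toMat-ε-identityˡ Id r s)) (·-identityʳ (toMat ε) r s)

module _ {m} (a b : Fin m → ℚi) (c : ℚi) (a′ b′ : Fin m → ℚi) (c′ : ℚi) where
  private
    X Y : Mat (suc (suc m))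
    X  = HMat a b c
    Y  = HMat a′ b′ c′
    a″ b″ : Fin m → ℚi
    a″ q = a q ⊕ a′ q
    b″ q = b q ⊕ b′ q
    c″ : ℚi
    c″ = c ⊕ c′ ⊕ dot a b′
    XY : Mat (suc (suc m))
    XY = HMat a″ b″ c″

  HMat-· : HMat a b c · HMat a′ b′ c′
           ≋ HMat (λ q → a q ⊕ a′ q) (λ q → b q ⊕ b′ q) (c ⊕ c′ ⊕ dot a b′)
  HMat-· r s with position r | position s
  ... | at-first | at-first =
    trans (HMat-·-first a b c Y zero)
          (cong (𝟙 ⊕_) (cong₂ _⊕_ (dot-zeroʳ a (λ _ → refl)) (zeroʳ c)))
  ... | at-first | at-middle q = begin
    (X · Y) zero (middle q)
      ≡⟨ HMat-·-first a b c Y (middle q) ⟩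
    Y zero (middle q) ⊕ (dot a (λ j → Y (middle j) (middle q)) ⊕ c ⊛ Y last (middle q))
      ≡⟨ cong₂ _⊕_ (HMat-first-middle a′ b′ c′ q)
           (cong₂ _⊕_ (trans (dot-congʳ a (λ j → HMat-middle-middle a′ b′ c′ j q)) (δ-sumʳ q a))
                      (trans (cong (c ⊛_) (HMat-last-middle a′ b′ c′ q)) (zeroʳ c))) ⟩
    a′ q ⊕ (a q ⊕ 𝟘)
      ≡⟨ trans (cong (a′ q ⊕_) (⊕-identityʳ (a q))) (⊕-comm (a′ q) (a q)) ⟩
    a q ⊕ a′ q
      ≡⟨ HMat-first-middle a″ b″ c″ q ⟨
    XY zero (middle q)
      ∎
  ... | at-first | at-last = begin
    (X · Y) zero last
      ≡⟨ HMat-·-first a b c Y last ⟩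
    Y zero last ⊕ (dot a (λ j → Y (middle j) last) ⊕ c ⊛ Y last last)
      ≡⟨ cong₂ _⊕_ (HMat-first-last a′ b′ c′)
           (cong₂ _⊕_ (dot-congʳ a (HMat-middle-last a′ b′ c′))
                      (trans (cong (c ⊛_) (HMat-last-last a′ b′ c′)) (⊛-identityʳ c))) ⟩
    c′ ⊕ (dot a b′ ⊕ c)
      ≡⟨ rotate c c′ (dot a b′) ⟩
    c ⊕ c′ ⊕ dot a b′
      ≡⟨ HMat-first-last a″ b″ c″ ⟨
    XY zero last
      ∎
    where
    rotate : ∀ c c′ d → c′ ⊕ (d ⊕ c) ≡ c ⊕ c′ ⊕ d
    rotate = solve-∀ ℚi-ring
  ... | at-middle p | at-first =
    trans (HMat-·-middle a b c Y p zero) (trans (cong (𝟘 ⊕_) (zeroʳ (b p))) (⊕-identityˡ 𝟘))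
  ... | at-middle p | at-middle q = begin
    (X · Y) (middle p) (middle q)
      ≡⟨ HMat-·-middle a b c Y p (middle q) ⟩
    Y (middle p) (middle q) ⊕ b p ⊛ Y last (middle q)
      ≡⟨ cong₂ _⊕_ (HMat-middle-middle a′ b′ c′ p q)
                   (trans (cong (b p ⊛_) (HMat-last-middle a′ b′ c′ q)) (zeroʳ (b p))) ⟩
    δ p q ⊕ 𝟘
      ≡⟨ ⊕-identityʳ (δ p q) ⟩
    δ p q
      ≡⟨ HMat-middle-middle a″ b″ c″ p q ⟨
    XY (middle p) (middle q)
      ∎
  ... | at-middle p | at-last = begin
    (X · Y) (middle p) last
      ≡⟨ HMat-·-middle a b c Y p last ⟩
    Y (middle p) last ⊕ b p ⊛ Y last last
      ≡⟨ cong₂ _⊕_ (HMat-middle-last a′ b′ c′ p)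
                   (trans (cong (b p ⊛_) (HMat-last-last a′ b′ c′)) (⊛-identityʳ (b p))) ⟩
    b′ p ⊕ b p
      ≡⟨ ⊕-comm (b′ p) (b p) ⟩
    b p ⊕ b′ p
      ≡⟨ HMat-middle-last a″ b″ c″ p ⟨
    XY (middle p) last
      ∎
  ... | at-last | at-first = HMat-·-last a b c Y zero
  ... | at-last | at-middle q =
    trans (HMat-·-last a b c Y (middle q))
          (trans (HMat-last-middle a′ b′ c′ q) (sym (HMat-last-middle a″ b″ c″ q)))
  ... | at-last | at-last =
    trans (HMat-·-last a b c Y last)
          (trans (HMat-last-last a′ b′ c′) (sym (HMat-last-last a″ b″ c″)))

toMat-∙ : ∀ {m} (x y : Hdata m) → toMat x · toMat y ≋ toMat (x ∙ y)
toMat-∙ x y = HMat-· (𝐚 x) (𝐛 x) (𝐜 x) (𝐚 y) (𝐛 y) (𝐜 y)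

toMat-^ : ∀ {m} (x : Hdata m) ℓ → toMat x ^ ℓ ≋ toMat (x ∙^ ℓ)
toMat-^ x zero    = toMat-ε
toMat-^ x (suc ℓ) r s =
  trans (·-cong {A = toMat x} (λ _ _ → refl) (toMat-^ x ℓ) r s) (toMat-∙ x (x ∙^ ℓ) r s)

prodF-toMat : ∀ {m} k (F : Fin k → Mat (suc (suc m))) (x : Fin k → Hdata m) →
              (∀ i → F i ≋ toMat (x i)) → prodF k F ≋ toMat (∏ k x)
prodF-toMat zero    F x F≋x = toMat-ε
prodF-toMat (suc k) F x F≋x r s =
  trans (·-cong (F≋x zero) (prodF-toMat k (λ i → F (suc i)) (λ i → x (suc i)) (F≋x ∘ suc)) r s)
        (toMat-∙ (x zero) (∏ k (λ i → x (suc i))) r s)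

Ω⇒balanced : ∀ {m} k (x : Fin k → Hdata m) → IsΩ (prodF k (λ i → toMat (x i))) →
             (∀ q → 𝐚Σ k x q ≡ 𝟘) × (∀ q → 𝐛Σ k x q ≡ 𝟘)
Ω⇒balanced k x (c , ∏∈Ω) = Σa≡0 , Σb≡0
  where
  ∏x≋Ω : toMat (∏ k x) ≋ HMat (𝐚 ε) (𝐛 ε) c
  ∏x≋Ω r s = trans (sym (prodF-toMat k (λ i → toMat (x i)) x (λ _ _ _ → refl) r s)) (∏∈Ω r s)
  Σa≡0 : ∀ q → 𝐚Σ k x q ≡ 𝟘
  Σa≡0 q = begin
    𝐚Σ k x q                         ≡⟨ ∏-𝐚 k x q ⟨
    𝐚 (∏ k x) q                      ≡⟨ HMat-first-middle (𝐚 (∏ k x)) (𝐛 (∏ k x)) (𝐜 (∏ k x)) q ⟨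
    toMat (∏ k x) zero (middle q)    ≡⟨ ∏x≋Ω zero (middle q) ⟩
    HMat (𝐚 ε) (𝐛 ε) c zero (middle q) ≡⟨ HMat-first-middle (𝐚 ε) (𝐛 ε) c q ⟩
    𝟘                                ∎
  Σb≡0 : ∀ q → 𝐛Σ k x q ≡ 𝟘
  Σb≡0 q = begin
    𝐛Σ k x q                         ≡⟨ ∏-𝐛 k x q ⟨
    𝐛 (∏ k x) q                      ≡⟨ HMat-middle-last (𝐚 (∏ k x)) (𝐛 (∏ k x)) (𝐜 (∏ k x)) q ⟨
    toMat (∏ k x) (middle q) last    ≡⟨ ∏x≋Ω (middle q) last ⟩
    HMat (𝐚 ε) (𝐛 ε) c (middle q) last ≡⟨ HMat-middle-last (𝐚 ε) (𝐛 ε) c q ⟩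
    𝟘                                ∎

lemma3 : (m k ℓ : ℕ) → (d : Fin k → Hdata m) →
    IsΩ (prodF k (λ i → toMat (d i))) → 1 ≤ ℓ →
    topRight (prodF k (λ i → toMat (d i) ^ ℓ))
      ≡ (ιℕ ℓ ⊛ sumFin k (λ i → 𝐜 (d i) ⊖ ι ½ ⊛ dot (𝐚 (d i)) (𝐛 (d i))))
        ⊕ (ι ½ ⊛ ιℕ (ℓ * ℓ) ⊛ commSum k d)
lemma3 m k ℓ d d∈Ω _ = begin
  topRight (prodF k (λ i → toMat (d i) ^ ℓ))
    ≡⟨ prodF-toMat k (λ i → toMat (d i) ^ ℓ) dˡ (λ i → toMat-^ (d i) ℓ) zero last ⟩
  toMat (∏ k dˡ) zero last
    ≡⟨ HMat-first-last (𝐚 (∏ k dˡ)) (𝐛 (∏ k dˡ)) (𝐜 (∏ k dˡ)) ⟩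
  𝐜 (∏ k dˡ)
    ≡⟨ 𝐜-∏-∙^ k d ℓ ⟩
  ιℕ ℓ ⊛ S ⊕ ι ½ ⊛ (ιℕ ℓ ⊛ ιℕ ℓ) ⊛ (diagonalPairings k d ⊕ (upperPairings k d ⊕ upperPairings k d))
    ≡⟨ cong₂ (λ L² C → ιℕ ℓ ⊛ S ⊕ ι ½ ⊛ L² ⊛ C) (sym (ιℕ-* ℓ ℓ)) (commSum-balanced k d Σa≡0 Σb≡0) ⟩
  ιℕ ℓ ⊛ S ⊕ ι ½ ⊛ ιℕ (ℓ * ℓ) ⊛ commSum k d
    ∎
  where
  dˡ = λ i → d i ∙^ ℓ
  S = sumFin k (λ i → 𝐜 (d i) ⊖ ι ½ ⊛ dot (𝐚 (d i)) (𝐛 (d i)))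
  Σa≡0 = proj₁ (Ω⇒balanced k d d∈Ω)
  Σb≡0 = proj₂ (Ω⇒balanced k d d∈Ω)
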